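{- Let $i\geq 1$ and $n\geq 0$ be integers. If $j\in\mathbb{N}$ satisfies $2^{i-1}<d_j(n)\leq 2^i$, then $d_j(n)=d_{i+1}(n)$. Furthermore, $2^{i-1}<d_{i+1}(n)\leq 2^i$ if and only if $-2^{i-1}<(n\bmod 2^{i+1})-2^i<2^{i-1}$.
   Context: For $i\in\mathbb{N}$ and $n\in\mathbb{N}_0$, $d_i(n)=2^{i-1}-\left|(n\bmod 2^i)-2^{i-1}\right|$. -}

module Defs where

open import Data.Nat using (ℕ; zero; suc; _^_; _%_)
open import Data.Nat.Properties using (m^n≢0)
open import Data.Integer using (ℤ; +_; _-_; ∣_∣)

mod2^ : ℕ → ℕ → ℕ
mod2^ n i = _%_ n (2 ^ i) {{m^n≢0 2 i}}

-- d_i(n) = 2^(i-1) - |(n mod 2^i) - 2^(i-1)|, as an integer.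
-- Only meaningful for i ≥ 1; the value at i = 0 is a dummy (0) and is
-- never used, since the statement requires i, j ≥ 1.
d : ℕ → ℕ → ℤ
d zero    n = + 0
d (suc k) n = + (2 ^ k) - + ∣ + (mod2^ n (suc k)) - + (2 ^ k) ∣

-- d_j(n) is the distance from n to the nearest multiple of 2^j.  The lower bound
-- 2^(i-1) < d_j(n) ≤ 2^(j-1) forces i < j, so 2^(i+1) divides 2^j.  A multiple of
-- 2^j within distance 2^i of n is then a multiple of 2^(i+1) within half a period
-- of n, hence a nearest one, so d_{i+1}(n) = d_j(n).  For the second part,
-- d_{i+1}(n) = 2^i - |x| with x = (n mod 2^(i+1)) - 2^i, which exceeds 2^(i-1)
-- exactly when |x| < 2^(i-1).
module Submission where

open import Defs
open import Data.Nat using (ℕ; suc; _^_)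
open import Data.Integer using (ℤ; +_; -_; _-_; _<_; _≤_)
open import Data.Product using (_×_)
open import Relation.Binary.PropositionalEquality using (_≡_)
open import Function.Bundles using (_⇔_)

open import Data.Nat as ℕ using (_*_; _∸_; _%_; NonZero)
import Data.Nat.Properties as ℕ
open import Data.Nat.DivMod using (%-remove-+ʳ; m<n⇒m%n≡m; m%n<n; m∣n⇒o%n%m≡o%m)
open import Data.Nat.Divisibility using (_∣_; ∣-refl; m∣m*n; ∣m+n∣m⇒∣n; ∣⇒≤)
open import Data.Integer using (-[1+_]; ∣_∣; _⊖_; -<+)
open import Data.Integer.Properties
import Algebra.Properties.CommutativeSemigroup +-commutativeSemigroup as +-CS
open import Data.Product using (_,_)
open import Data.Sum using (inj₁; inj₂)
open import Relation.Binary.PropositionalEquality using (sym; trans; cong; subst; module ≡-Reasoning)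
open import Function.Bundles using (mk⇔; Equivalence)

2n∸n≡n : ∀ n → 2 * n ∸ n ≡ n
2n∸n≡n n = trans (ℕ.m+n∸m≡n n (n ℕ.+ 0)) (ℕ.+-identityʳ n)

n<2n : ∀ n .{{_ : NonZero n}} → n ℕ.< 2 * n
n<2n n = subst (n ℕ.<_) (ℕ.*-comm n 2) (ℕ.m<m*n n 2 (ℕ.s≤s (ℕ.s≤s ℕ.z≤n)))

^-cancelʳ-< : ∀ m .{{_ : NonZero m}} {n o} → m ^ n ℕ.< m ^ o → n ℕ.< o
^-cancelʳ-< m lt = ℕ.≰⇒> λ o≤n → ℕ.<⇒≱ lt (ℕ.^-monoʳ-≤ m o≤n)

m^n∣m^o : ∀ m {n o} → n ℕ.≤ o → m ^ n ∣ m ^ o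
m^n∣m^o m {n} {o} n≤o =
  subst (m ^ n ∣_) (trans (sym (ℕ.^-distribˡ-+-* m n (o ∸ n))) (cong (m ^_) (ℕ.m+[n∸m]≡n n≤o)))
        (m∣m*n (m ^ (o ∸ n)))

[n∸s]%m≡m∸s : ∀ {m n s} .{{_ : NonZero m}} → m ∣ n → m ℕ.≤ n → 0 ℕ.< s → s ℕ.≤ m →
              (n ∸ s) % m ≡ m ∸ s
[n∸s]%m≡m∸s {m} {n} {s} m∣n m≤n 0<s s≤m = begin
  (n ∸ s) % m                 ≡⟨ cong (λ k → (k ∸ s) % m) (ℕ.m∸n+n≡m m≤n) ⟨
  ((n ∸ m) ℕ.+ m ∸ s) % m     ≡⟨ cong (_% m) (ℕ.+-∸-assoc (n ∸ m) s≤m) ⟩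
  ((n ∸ m) ℕ.+ (m ∸ s)) % m   ≡⟨ cong (_% m) (ℕ.+-comm (n ∸ m) (m ∸ s)) ⟩
  ((m ∸ s) ℕ.+ (n ∸ m)) % m   ≡⟨ %-remove-+ʳ (m ∸ s) m∣n∸m ⟩
  (m ∸ s) % m                 ≡⟨ m<n⇒m%n≡m (ℕ.∸-monoʳ-< 0<s s≤m) ⟩
  m ∸ s                       ∎
  where
  open ≡-Reasoning
  m∣n∸m : m ∣ n ∸ m
  m∣n∸m = ∣m+n∣m⇒∣n (subst (m ∣_) (sym (ℕ.m+[n∸m]≡n m≤n)) m∣n) ∣-refl

+m-+n≡+[m∸n] : ∀ {m n} → n ℕ.≤ m → + m - + n ≡ + (m ∸ n)
+m-+n≡+[m∸n] {m} {n} n≤m = trans (m-n≡m⊖n m n) (⊖-≥ n≤m)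

+2n-+n≡+n : ∀ n → + (2 * n) - + n ≡ + n
+2n-+n≡+n n = trans (+m-+n≡+[m∸n] (ℕ.m≤m+n n _)) (cong +_ (2n∸n≡n n))

∣i∣<n⇔-n<i<n : ∀ n i → + ∣ i ∣ < + n ⇔ (- + n < i × i < + n)
∣i∣<n⇔-n<i<n n (+ m)    = mk⇔ (λ m<n → <-≤-trans (neg-mono-< m<n) neg-≤-pos , m<n)
                              (λ (_ , m<n) → m<n)
∣i∣<n⇔-n<i<n n -[1+ m ] = mk⇔ (λ m<n → neg-mono-< m<n , -<+)
                              (λ (-n<i , _) → neg-cancel-< -n<i)

n<2n-i⇔i<n : ∀ n i → + n < + (2 * n) - i ⇔ i < + n
n<2n-i⇔i<n n i = mk⇔
  (λ n<2n-i → ≰⇒> λ n≤i → <⇒≱ n<2n-i (begin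
    + (2 * n) - i    ≤⟨ +-monoʳ-≤ (+ (2 * n)) (neg-mono-≤ n≤i) ⟩
    + (2 * n) - + n  ≡⟨ +2n-+n≡+n n ⟩
    + n              ∎))
  (λ i<n → begin-strict
    + n              ≡⟨ +2n-+n≡+n n ⟨
    + (2 * n) - + n  <⟨ +-monoʳ-< (+ (2 * n)) (neg-mono-< i<n) ⟩
    + (2 * n) - i    ∎)
  where open ≤-Reasoning

-- For r ≤ 2a this is min r (2a ∸ r), the distance from r to {0, 2a};
-- d (suc k) n is definitionally tent (2 ^ k) (mod2^ n (suc k)).
tent : ℕ → ℕ → ℤ
tent a r = + a - + ∣ + r - + a ∣

tent≤a : ∀ a r → tent a r ≤ + a
tent≤a a r = i-j≤i (+ a) (+ ∣ + r - + a ∣)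

tent-≤ : ∀ {a r} → r ℕ.≤ a → tent a r ≡ + r
tent-≤ {a} {r} r≤a = begin
  + a - + ∣ + r - + a ∣  ≡⟨ cong (λ k → + a - + ∣ k ∣) (m-n≡m⊖n r a) ⟩
  + a - + ∣ r ⊖ a ∣      ≡⟨ cong (λ k → + a - + k) (∣⊖∣-≤ r≤a) ⟩
  + a - + (a ∸ r)        ≡⟨ +m-+n≡+[m∸n] (ℕ.m∸n≤m a r) ⟩
  + (a ∸ (a ∸ r))        ≡⟨ cong +_ (ℕ.m∸[m∸n]≡n r≤a) ⟩
  + r                    ∎
  where open ≡-Reasoning

tent-reflect : ∀ a {r} → r ℕ.≤ 2 * a → tent a (2 * a ∸ r) ≡ tent a r
tent-reflect a {r} r≤2a = cong (λ k → + a - + k) (begin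
  ∣ + (2 * a ∸ r) - + a ∣       ≡⟨ cong (λ k → ∣ k - + a ∣) (+m-+n≡+[m∸n] r≤2a) ⟨
  ∣ + (2 * a) - + r - + a ∣     ≡⟨ cong ∣_∣ (+-CS.xy∙z≈xz∙y (+ (2 * a)) (- + r) (- + a)) ⟩
  ∣ + (2 * a) - + a - + r ∣     ≡⟨ cong (λ k → ∣ k - + r ∣) (+2n-+n≡+n a) ⟩
  ∣ + a - + r ∣                 ≡⟨ ∣i-j∣≡∣j-i∣ (+ a) (+ r) ⟩
  ∣ + r - + a ∣                 ∎)
  where open ≡-Reasoning

tent-coarsen : ∀ {a b r} .{{_ : NonZero (2 * b)}} → r ℕ.< 2 * a → 2 * b ∣ 2 * a →
               tent a r ≤ + b → tent a r ≡ tent b (r % (2 * b))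
tent-coarsen {a} {b} {r} r<2a 2b∣2a tent≤b with ℕ.≤-total r a
... | inj₁ r≤a = begin
  tent a r            ≡⟨ tent-≤ r≤a ⟩
  + r                 ≡⟨ tent-≤ r≤b ⟨
  tent b r            ≡⟨ cong (tent b) (m<n⇒m%n≡m r<2b) ⟨
  tent b (r % (2 * b)) ∎
  where
  open ≡-Reasoning
  r≤b : r ℕ.≤ b
  r≤b = drop‿+≤+ (subst (_≤ + b) (tent-≤ r≤a) tent≤b)
  r<2b : r ℕ.< 2 * b
  r<2b = ℕ.≤-<-trans r≤b (n<2n b {{ℕ.m*n≢0⇒n≢0 2}})
... | inj₂ a≤r = begin
  tent a r                    ≡⟨ tent-reflect a r≤2a ⟨
  tent a s                    ≡⟨ tent-≤ s≤a ⟩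
  + s                         ≡⟨ tent-≤ s≤b ⟨
  tent b s                    ≡⟨ tent-reflect b s≤2b ⟨
  tent b (2 * b ∸ s)          ≡⟨ cong (tent b) r%2b≡2b∸s ⟨
  tent b (r % (2 * b))        ∎
  where
  open ≡-Reasoning
  r≤2a : r ℕ.≤ 2 * a
  r≤2a = ℕ.<⇒≤ r<2a
  s : ℕ
  s = 2 * a ∸ r
  s≤a : s ℕ.≤ a
  s≤a = subst (s ℕ.≤_) (2n∸n≡n a) (ℕ.∸-monoʳ-≤ (2 * a) a≤r)
  s≤b : s ℕ.≤ b
  s≤b = drop‿+≤+ (subst (_≤ + b) (trans (sym (tent-reflect a r≤2a)) (tent-≤ s≤a)) tent≤b)
  s≤2b : s ℕ.≤ 2 * b
  s≤2b = ℕ.≤-trans s≤b (ℕ.m≤m+n b _)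
  2b≤2a : 2 * b ℕ.≤ 2 * a
  2b≤2a = ∣⇒≤ {{ℕ.>-nonZero (ℕ.≤-<-trans ℕ.z≤n r<2a)}} 2b∣2a
  r%2b≡2b∸s : r % (2 * b) ≡ 2 * b ∸ s
  r%2b≡2b∸s = begin
    r % (2 * b)            ≡⟨ cong (_% (2 * b)) (ℕ.m∸[m∸n]≡n r≤2a) ⟨
    (2 * a ∸ s) % (2 * b)  ≡⟨ [n∸s]%m≡m∸s 2b∣2a 2b≤2a (ℕ.m<n⇒0<n∸m r<2a) s≤2b ⟩
    2 * b ∸ s              ∎

h<tent[2h]⇔-h<r-2h<h : ∀ h r →
  (+ h < tent (2 * h) r × tent (2 * h) r ≤ + (2 * h)) ⇔
  (- + h < + r - + (2 * h) × + r - + (2 * h) < + h)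
h<tent[2h]⇔-h<r-2h<h h r = mk⇔
  (λ (h<tent , _) → to (∣i∣<n⇔-n<i<n h x) (to (n<2n-i⇔i<n h (+ ∣ x ∣)) h<tent))
  (λ -h<x<h → from (n<2n-i⇔i<n h (+ ∣ x ∣)) (from (∣i∣<n⇔-n<i<n h x) -h<x<h) , tent≤a (2 * h) r)
  where
  open Equivalence
  x : ℤ
  x = + r - + (2 * h)

d-coarsen : ∀ {i j} n → i ℕ.≤ j → d (suc j) n ≤ + (2 ^ i) → d (suc j) n ≡ d (suc i) n
d-coarsen {i} {j} n i≤j d≤2^i = begin
  d (suc j) n                                 ≡⟨ tent-coarsen {2 ^ j} {2 ^ i} (m%n<n n (2 ^ suc j)) 2^1+i∣2^1+j d≤2^i ⟩
  tent (2 ^ i) (mod2^ n (suc j) % 2 ^ suc i)  ≡⟨ cong (tent (2 ^ i)) (m∣n⇒o%n%m≡o%m _ _ n 2^1+i∣2^1+j) ⟩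
  d (suc i) n                                 ∎
  where
  open ≡-Reasoning
  instance
    _ = ℕ.m^n≢0 2 (suc i)
    _ = ℕ.m^n≢0 2 (suc j)
  2^1+i∣2^1+j : 2 ^ suc i ∣ 2 ^ suc j
  2^1+i∣2^1+j = m^n∣m^o 2 (ℕ.s≤s i≤j)

lemma14 : (i n : ℕ) → 1 Data.Nat.≤ i →
    ((j : ℕ) → 1 Data.Nat.≤ j →
      + (2 ^ (i Data.Nat.∸ 1)) < d j n → d j n ≤ + (2 ^ i) → d j n ≡ d (suc i) n)
    × ((+ (2 ^ (i Data.Nat.∸ 1)) < d (suc i) n × d (suc i) n ≤ + (2 ^ i))
        ⇔ (- + (2 ^ (i Data.Nat.∸ 1)) < + (mod2^ n (suc i)) - + (2 ^ i)
           × + (mod2^ n (suc i)) - + (2 ^ i) < + (2 ^ (i Data.Nat.∸ 1))))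
lemma14 (suc k) n _ = coincide , h<tent[2h]⇔-h<r-2h<h (2 ^ k) (mod2^ n (suc (suc k)))
  where
  coincide : (j : ℕ) → 1 ℕ.≤ j → + (2 ^ k) < d j n → d j n ≤ + (2 ^ suc k) → d j n ≡ d (suc (suc k)) n
  coincide (suc m) _ 2^k<d = d-coarsen n k<m
    where
    k<m : k ℕ.< m
    k<m = ^-cancelʳ-< 2 (drop‿+<+ (<-≤-trans 2^k<d (tent≤a (2 ^ m) (mod2^ n (suc m)))))
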